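{- Let $\mathsf{Lic}$ be a coherent zone discipline on $\mathbf{Arch}_Z$ with extracted signature $\Sigma_{\mathsf{Lic}}=(Z,\preceq,\mathcal{W}_{\mathsf{Lic}},\mathcal{C}_{\mathsf{Lic}})$, and fix an assignment $\rho$ of atoms to objects of $\mathbf{Ctx}$. For every derivation $\pi$ of a sequent $\Gamma\vdash A$ in $\mathsf{TZ}_{\Sigma_{\mathsf{Lic}}}$ there exists a morphism $[\![\pi]\!]\colon[\![\Gamma]\!]\to\mathrm{Out}(A)$ of $\mathbf{Arch}_{\widehat Z}$ belonging to $\mathrm{Diag}_{\mathsf{Lic}}$. Moreover, if the last rule of $\pi$ is an instance of $\mathrm{W}_z$, then the construction of $[\![\pi]\!]$ uses the designated discard family $\omega_{z,- }$, and if the last rule of $\pi$ is an instance of $\mathrm{C}_z$, then the construction of $[\![\pi]\!]$ uses the designated diagonal family $\delta_{z,- }$.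
   Context: Let $\mathbf{Ctx}$ be a category with finite products, $Z$ a set of zones, $\mathsf{o}\notin Z$ and $\widehat Z=Z\sqcup\{\mathsf{o}\}$. For a label set $Y$, $\mathbf{Arch}_Y$ is the symmetric monoidal category whose objects are finite lists $((z_1,A_1),\dots,(z_n,A_n))$ with $z_i\in Y$, $A_i\in\mathrm{Ob}(\mathbf{Ctx})$ (carrier $A_1\times\cdots\times A_n$), whose morphisms $\Gamma\to\Delta$ are classes $[\![P,\varphi]\!]$ of pairs ($P$ an object, $\varphi\colon P\times[\![\Gamma]\!]\to[\![\Delta]\!]$) modulo isomorphic reparametrisation of $P$, with sequential composition, tensor given by concatenation, unit the empty list $\emptyset$; $J_z(A)=((z,A))$, $J_z(f)=[\![1,f\circ\pi_2]\!]$. $\mathbf{Arch}_Z$ sits canonically inside $\mathbf{Arch}_{\widehat Z}$. A coherent zone discipline $\mathsf{Lic}$ consists of a preorder $\preceq$ on $Z$, natural coercions $\chi_{z,z',X}\colon J_z(X)\to J_{z'}(X)$ for $z\preceq z'$ (identity when $z=z'$, closed under composition), upward-closed $\mathcal{W}_{\mathsf{Lic}},\mathcal{C}_{\mathsf{Lic}}\subseteq Z$, discards $\omega_{z,X}\colon J_z(X)\to\emptyset$ for $z\in\mathcal{W}_{\mathsf{Lic}}$ and diagonals $\delta_{z,X}\colon J_z(X)\to J_z(X)\otimes J_z(X)$ for $z\in\mathcal{C}_{\mathsf{Lic}}$, all natural in $X$ and compatible with coercions. Tensorial formulas: $A::=p\mid I\mid A\otimes B$; zone contexts are finite multisets of $z{:}A$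 with $z\in Z$. $\mathsf{TZ}_{\Sigma}$ for $\Sigma=(Z,\preceq,\mathcal{W},\mathcal{C})$ has rules: axiom $z{:}A\vdash A$; $\emptyset\vdash I$; $\otimes\mathrm{R}$ (from $\Gamma\vdash A$, $\Delta\vdash B$ infer $\Gamma,\Delta\vdash A\otimes B$); $\otimes\mathrm{L}$ (from $\Gamma,z{:}A,z{:}B\vdash C$ infer $\Gamma,z{:}A\otimes B\vdash C$); $I\mathrm{L}$ (from $\Gamma\vdash C$ infer $\Gamma,z{:}I\vdash C$); cut (from $\Gamma\vdash A$ and $\Delta,z{:}A\vdash B$ infer $\Gamma,\Delta\vdash B$); $\mathrm{W}_z$ for $z\in\mathcal{W}$ (from $\Gamma\vdash B$ infer $\Gamma,z{:}A\vdash B$); $\mathrm{C}_z$ for $z\in\mathcal{C}$ (from $\Gamma,z{:}A,z{:}A\vdash B$ infer $\Gamma,z{:}A\vdash B$). Semantics: $[\![p]\!]=\rho(p)$, $[\![I]\!]=1$, $[\![A\otimes B]\!]=[\![A]\!]\times[\![B]\!]$; for an ordered representative $\Gamma=(z_1{:}A_1,\dots,z_n{:}A_n)$, $[\![\Gamma]\!]=J_{z_1}([\![A_1]\!])\otimes\cdots\otimes J_{z_n}([\![A_n]\!])$ (and $[\![\emptyset]\!]=\emptyset$); different orderings give objects related by canonical symmetric monoidal isomorphisms. $\mathrm{Out}(A)=J_{\mathsf{o}}([\![A]\!])$. Interface blocks (for $z\in Z$, formulas $A,B$): $r_{z,A}\colon J_z([\![A]\!])\to\mathrm{Out}(A)$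 and $\iota_{z,A}\colon\mathrm{Out}(A)\to J_z([\![A]\!])$, both the class of $(1,\pi_2)$ (induced by $\mathrm{id}_{[\![A]\!]}$); $\tau_{A,B}\colon\mathrm{Out}(A)\otimes\mathrm{Out}(B)\to\mathrm{Out}(A\otimes B)$ and $\mu_{z,A,B}\colon J_z([\![A\otimes B]\!])\to J_z([\![A]\!])\otimes J_z([\![B]\!])$ induced by the identity of $[\![A]\!]\times[\![B]\!]$; $\eta\colon\emptyset\to\mathrm{Out}(I)$ induced by $\mathrm{id}_1$; $\nu_z\colon J_z(1)\to\emptyset$ induced by $1\to1$. $\mathrm{Diag}_{\mathsf{Lic}}$ is the smallest class of morphisms in $\mathbf{Arch}_{\widehat Z}$ containing all identities, associators, unitors, symmetries, all interface blocks, all coercions $\chi_{z,z',X}$, all discards $\omega_{z,X}$ ($z\in\mathcal{W}_{\mathsf{Lic}}$), all diagonals $\delta_{z,X}$ ($z\in\mathcal{C}_{\mathsf{Lic}}$), and closed under composition and tensor product. -}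

module Defs where

open import Level using (Level; _⊔_) renaming (suc to lsuc)
open import Data.List using (List; []; _∷_; _++_; map)
open import Data.Product using (Σ; _,_; proj₁; proj₂; Σ-syntax) renaming (_×_ to _×ₚ_)
open import Relation.Binary using (Rel; IsEquivalence; IsPreorder)
open import Relation.Binary.PropositionalEquality using (_≡_; refl)
open import Data.List.Relation.Binary.Permutation.Propositional using (_↭_)
open import Data.Empty using (⊥)

record FPCat (o ℓ e : Level) : Set (lsuc (o ⊔ ℓ ⊔ e)) where
  infixr 9 _∘_
  infix 4 _≈_
  infixr 7 _×_
  field
    Obj : Set o
    Hom : Obj → Obj → Set ℓ
    _≈_ : ∀ {A B} → Rel (Hom A B) e
    ≈-equiv : ∀ {A B} → IsEquivalence (_≈_ {A} {B})
    id : ∀ {A} → Hom A A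
    _∘_ : ∀ {A B C} → Hom B C → Hom A B → Hom A C
    identityˡ : ∀ {A B} {f : Hom A B} → id ∘ f ≈ f
    identityʳ : ∀ {A B} {f : Hom A B} → f ∘ id ≈ f
    assoc : ∀ {A B C D} {f : Hom A B} {g : Hom B C} {h : Hom C D} →
            (h ∘ g) ∘ f ≈ h ∘ (g ∘ f)
    ∘-resp-≈ : ∀ {A B C} {f f' : Hom B C} {g g' : Hom A B} →
               f ≈ f' → g ≈ g' → f ∘ g ≈ f' ∘ g'
    ⊤ : Obj
    ! : ∀ {A} → Hom A ⊤
    !-unique : ∀ {A} (f : Hom A ⊤) → f ≈ !
    _×_ : Obj → Obj → Obj
    π₁ : ∀ {A B} → Hom (A × B) A
    π₂ : ∀ {A B} → Hom (A × B) B
    ⟨_,_⟩ : ∀ {X A B} → Hom X A → Hom X B → Hom X (A × B)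
    π₁∘⟨⟩ : ∀ {X A B} {f : Hom X A} {g : Hom X B} → π₁ ∘ ⟨ f , g ⟩ ≈ f
    π₂∘⟨⟩ : ∀ {X A B} {f : Hom X A} {g : Hom X B} → π₂ ∘ ⟨ f , g ⟩ ≈ g
    ⟨⟩-unique : ∀ {X A B} {f : Hom X A} {g : Hom X B} {h : Hom X (A × B)} →
                π₁ ∘ h ≈ f → π₂ ∘ h ≈ g → h ≈ ⟨ f , g ⟩

  _⊗₁_ : ∀ {A B C D} → Hom A B → Hom C D → Hom (A × C) (B × D)
  f ⊗₁ g = ⟨ f ∘ π₁ , g ∘ π₂ ⟩

  record IsIso {A B : Obj} (f : Hom A B) : Set (ℓ ⊔ e) where
    field
      inv : Hom B A
      isoˡ : inv ∘ f ≈ id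
      isoʳ : f ∘ inv ≈ id

-- The symmetric monoidal category Arch over the label set
--   Ẑ = Z ⊔ {o}   (Arch_Z sits inside it as the lists using only zone labels).

module Arch {o ℓ e : Level} (𝒞 : FPCat o ℓ e) (Z : Set) where
  open FPCat 𝒞

  data Ẑ : Set where
    zone : Z → Ẑ
    out  : Ẑ

  ArchObj : Set o
  ArchObj = List (Ẑ ×ₚ Obj)

  car : ArchObj → Obj
  car [] = ⊤
  car ((_ , A) ∷ []) = A
  car ((_ , A) ∷ (x ∷ Γ)) = A × car (x ∷ Γ)

  split : (Γ Δ : ArchObj) → Hom (car (Γ ++ Δ)) (car Γ × car Δ)
  split [] Δ = ⟨ ! , id ⟩
  split (x ∷ []) [] = ⟨ id , ! ⟩
  split (x ∷ []) (y ∷ Δ) = id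
  split (x ∷ y ∷ Γ) Δ =
    ⟨ ⟨ π₁ , π₁ ∘ split (y ∷ Γ) Δ ∘ π₂ ⟩ , π₂ ∘ split (y ∷ Γ) Δ ∘ π₂ ⟩

  merge : (Γ Δ : ArchObj) → Hom (car Γ × car Δ) (car (Γ ++ Δ))
  merge [] Δ = π₂
  merge (x ∷ []) [] = π₁
  merge (x ∷ []) (y ∷ Δ) = id
  merge (x ∷ y ∷ Γ) Δ = ⟨ π₁ ∘ π₁ , merge (y ∷ Γ) Δ ∘ ⟨ π₂ ∘ π₁ , π₂ ⟩ ⟩

  record ArchHom (Γ Δ : ArchObj) : Set (o ⊔ ℓ) where
    constructor ⟦_,_⟧
    field
      P : Obj
      φ : Hom (P × car Γ) (car Δ)

  -- equality of classes: isomorphic reparametrisation of P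
  infix 4 _≈A_
  _≈A_ : ∀ {Γ Δ} → ArchHom Γ Δ → ArchHom Γ Δ → Set (ℓ ⊔ e)
  ⟦ P , φ ⟧ ≈A ⟦ Q , ψ ⟧ = Σ[ α ∈ Hom P Q ] (IsIso α ×ₚ (ψ ∘ (α ⊗₁ id) ≈ φ))

  idA : ∀ {Γ} → ArchHom Γ Γ
  idA = ⟦ ⊤ , π₂ ⟧

  infixr 9 _∘A_
  _∘A_ : ∀ {Γ Δ Θ} → ArchHom Δ Θ → ArchHom Γ Δ → ArchHom Γ Θ
  ⟦ Q , ψ ⟧ ∘A ⟦ P , φ ⟧ = ⟦ Q × P , ψ ∘ ⟨ π₁ ∘ π₁ , φ ∘ ⟨ π₂ ∘ π₁ , π₂ ⟩ ⟩ ⟧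

  infixr 8 _⊗A_
  _⊗A_ : ∀ {Γ Δ Γ' Δ'} → ArchHom Γ Δ → ArchHom Γ' Δ' → ArchHom (Γ ++ Γ') (Δ ++ Δ')
  _⊗A_ {Γ} {Δ} {Γ'} {Δ'} ⟦ P , φ ⟧ ⟦ Q , ψ ⟧ =
    ⟦ P × Q , merge Δ Δ' ∘ ⟨ φ ∘ ⟨ π₁ ∘ π₁ , π₁ ∘ split Γ Γ' ∘ π₂ ⟩
                            , ψ ∘ ⟨ π₂ ∘ π₁ , π₂ ∘ split Γ Γ' ∘ π₂ ⟩ ⟩ ⟧

  assocA : ∀ Γ Δ Θ → ArchHom ((Γ ++ Δ) ++ Θ) (Γ ++ (Δ ++ Θ))
  assocA Γ Δ Θ = ⟦ ⊤ , merge Γ (Δ ++ Θ) ∘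
    ⟨ π₁ ∘ split Γ Δ ∘ π₁ ∘ split (Γ ++ Δ) Θ ∘ π₂
    , merge Δ Θ ∘ ⟨ π₂ ∘ split Γ Δ ∘ π₁ ∘ split (Γ ++ Δ) Θ ∘ π₂
                  , π₂ ∘ split (Γ ++ Δ) Θ ∘ π₂ ⟩ ⟩ ⟧

  assocA⁻¹ : ∀ Γ Δ Θ → ArchHom (Γ ++ (Δ ++ Θ)) ((Γ ++ Δ) ++ Θ)
  assocA⁻¹ Γ Δ Θ = ⟦ ⊤ , merge (Γ ++ Δ) Θ ∘
    ⟨ merge Γ Δ ∘ ⟨ π₁ ∘ split Γ (Δ ++ Θ) ∘ π₂
                  , π₁ ∘ split Δ Θ ∘ π₂ ∘ split Γ (Δ ++ Θ) ∘ π₂ ⟩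
    , π₂ ∘ split Δ Θ ∘ π₂ ∘ split Γ (Δ ++ Θ) ∘ π₂ ⟩ ⟧

  lunitA : ∀ Γ → ArchHom ([] ++ Γ) Γ
  lunitA Γ = ⟦ ⊤ , π₂ ⟧

  lunitA⁻¹ : ∀ Γ → ArchHom Γ ([] ++ Γ)
  lunitA⁻¹ Γ = ⟦ ⊤ , π₂ ⟧

  runitA : ∀ Γ → ArchHom (Γ ++ []) Γ
  runitA Γ = ⟦ ⊤ , π₁ ∘ split Γ [] ∘ π₂ ⟧

  runitA⁻¹ : ∀ Γ → ArchHom Γ (Γ ++ [])
  runitA⁻¹ Γ = ⟦ ⊤ , merge Γ [] ∘ ⟨ π₂ , ! ⟩ ⟧

  symA : ∀ Γ Δ → ArchHom (Γ ++ Δ) (Δ ++ Γ)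
  symA Γ Δ = ⟦ ⊤ , merge Δ Γ ∘ ⟨ π₂ , π₁ ⟩ ∘ split Γ Δ ∘ π₂ ⟧

  J : Ẑ → Obj → ArchObj
  J y A = (y , A) ∷ []

  J₁ : ∀ (y : Ẑ) {A B} → Hom A B → ArchHom (J y A) (J y B)
  J₁ y f = ⟦ ⊤ , f ∘ π₂ ⟧

  induced : ∀ {Γ} → ArchHom Γ Γ
  induced = ⟦ ⊤ , π₂ ⟧

record Discipline {o ℓ e : Level} (𝒞 : FPCat o ℓ e) (Z : Set) : Set (lsuc (o ⊔ ℓ ⊔ e)) where
  open FPCat 𝒞
  open Arch 𝒞 Z
  field
    _≼_ : Z → Z → Set
    ≼-isPreorder : IsPreorder _≡_ _≼_
    χ : ∀ {z z'} → .(z ≼ z') → (X : Obj) → ArchHom (J (zone z) X) (J (zone z') X)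
    χ-natural : ∀ {z z' X Y} .(p : z ≼ z') (f : Hom X Y) →
                χ p Y ∘A J₁ (zone z) f ≈A J₁ (zone z') f ∘A χ p X
    χ-id : ∀ {z} .(p : z ≼ z) (X : Obj) → χ p X ≈A idA
    χ-comp : ∀ {z z' z''} .(p : z ≼ z') .(q : z' ≼ z'') .(r : z ≼ z'') (X : Obj) →
             χ q X ∘A χ p X ≈A χ r X
    𝒲 : Z → Set
    𝒞𝓏 : Z → Set
    𝒲-up : ∀ {z z'} → 𝒲 z → z ≼ z' → 𝒲 z'
    𝒞𝓏-up : ∀ {z z'} → 𝒞𝓏 z → z ≼ z' → 𝒞𝓏 z'
    ω : ∀ {z} → .(𝒲 z) → (X : Obj) → ArchHom (J (zone z) X) []
    ω-natural : ∀ {z X Y} .(w : 𝒲 z) (f : Hom X Y) →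
                ω w Y ∘A J₁ (zone z) f ≈A ω w X
    ω-coercion : ∀ {z z'} .(w : 𝒲 z) .(w' : 𝒲 z') .(p : z ≼ z') (X : Obj) →
                 ω w' X ∘A χ p X ≈A ω w X
    δ : ∀ {z} → .(𝒞𝓏 z) → (X : Obj) →
        ArchHom (J (zone z) X) (J (zone z) X ++ J (zone z) X)
    δ-natural : ∀ {z X Y} .(c : 𝒞𝓏 z) (f : Hom X Y) →
                δ c Y ∘A J₁ (zone z) f ≈A (J₁ (zone z) f ⊗A J₁ (zone z) f) ∘A δ c X
    δ-coercion : ∀ {z z'} .(c : 𝒞𝓏 z) .(c' : 𝒞𝓏 z') .(p : z ≼ z') (X : Obj) →
                 δ c' X ∘A χ p X ≈A (χ p X ⊗A χ p X) ∘A δ c X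

module TZ (Atom : Set) (Z : Set) (𝒲 𝒞𝓏 : Z → Set) where

  infixr 7 _⊗_
  data Form : Set where
    atom : Atom → Form
    I    : Form
    _⊗_  : Form → Form → Form

  -- a zone context is a finite multiset of z : A; it is represented by
  -- any list, and every rule allows its conclusion to be any reordering
  ZCtx : Set
  ZCtx = List (Z ×ₚ Form)

  infix 3 _⊢_
  data _⊢_ : ZCtx → Form → Set where
    ax   : ∀ {Γ z A} → Γ ↭ ((z , A) ∷ []) → Γ ⊢ A
    IR   : ∀ {Γ} → Γ ↭ [] → Γ ⊢ I
    ⊗R   : ∀ {Γ Γ₁ Γ₂ A B} → Γ ↭ Γ₁ ++ Γ₂ → Γ₁ ⊢ A → Γ₂ ⊢ B → Γ ⊢ A ⊗ B
    ⊗L   : ∀ {Γ' Γ z A B C} → Γ' ↭ (z , A ⊗ B) ∷ Γ →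
           (z , A) ∷ (z , B) ∷ Γ ⊢ C → Γ' ⊢ C
    IL   : ∀ {Γ' Γ z C} → Γ' ↭ (z , I) ∷ Γ → Γ ⊢ C → Γ' ⊢ C
    cut  : ∀ {Γ' Γ Δ z A B} → Γ' ↭ Γ ++ Δ → Γ ⊢ A → (z , A) ∷ Δ ⊢ B → Γ' ⊢ B
    W    : ∀ {Γ' Γ A B} (z : Z) → 𝒲 z → Γ' ↭ (z , A) ∷ Γ → Γ ⊢ B → Γ' ⊢ B
    C    : ∀ {Γ' Γ A B} (z : Z) → 𝒞𝓏 z → Γ' ↭ (z , A) ∷ Γ →
           (z , A) ∷ (z , A) ∷ Γ ⊢ B → Γ' ⊢ B

  LastRuleW : ∀ {Γ A} → Γ ⊢ A → Z → Set
  LastRuleW (W z _ _ _) z' = z ≡ z'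
  LastRuleW _ _ = ⊥

  LastRuleC : ∀ {Γ A} → Γ ⊢ A → Z → Set
  LastRuleC (C z _ _ _) z' = z ≡ z'
  LastRuleC _ _ = ⊥

module Semantics {o ℓ e : Level} (𝒞 : FPCat o ℓ e) (Z : Set)
                 (Lic : Discipline 𝒞 Z) (Atom : Set) (ρ : Atom → FPCat.Obj 𝒞) where
  open FPCat 𝒞
  open Arch 𝒞 Z public
  open Discipline Lic
  open TZ Atom Z 𝒲 𝒞𝓏 public

  ⟦_⟧F : Form → Obj
  ⟦ atom p ⟧F = ρ p
  ⟦ I ⟧F = ⊤
  ⟦ A ⊗ B ⟧F = ⟦ A ⟧F × ⟦ B ⟧F

  ⟦_⟧C : ZCtx → ArchObj
  ⟦ [] ⟧C = []
  ⟦ (z , A) ∷ Γ ⟧C = J (zone z) ⟦ A ⟧F ++ ⟦ Γ ⟧C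

  Out : Form → ArchObj
  Out A = J out ⟦ A ⟧F

  -- syntactic description of the generators and constructions of Diag_Lic
  data DiagTerm : ArchObj → ArchObj → Set o where
    idD     : ∀ Γ → DiagTerm Γ Γ
    assocD  : ∀ Γ Δ Θ → DiagTerm ((Γ ++ Δ) ++ Θ) (Γ ++ (Δ ++ Θ))
    assocD⁻¹ : ∀ Γ Δ Θ → DiagTerm (Γ ++ (Δ ++ Θ)) ((Γ ++ Δ) ++ Θ)
    lunitD  : ∀ Γ → DiagTerm ([] ++ Γ) Γ
    lunitD⁻¹ : ∀ Γ → DiagTerm Γ ([] ++ Γ)
    runitD  : ∀ Γ → DiagTerm (Γ ++ []) Γ
    runitD⁻¹ : ∀ Γ → DiagTerm Γ (Γ ++ [])
    symD    : ∀ Γ Δ → DiagTerm (Γ ++ Δ) (Δ ++ Γ)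
    rD  : ∀ (z : Z) A → DiagTerm (J (zone z) ⟦ A ⟧F) (Out A)
    ιD  : ∀ (z : Z) A → DiagTerm (Out A) (J (zone z) ⟦ A ⟧F)
    τD  : ∀ A B → DiagTerm (Out A ++ Out B) (Out (A ⊗ B))
    μD  : ∀ (z : Z) A B →
          DiagTerm (J (zone z) ⟦ A ⊗ B ⟧F) (J (zone z) ⟦ A ⟧F ++ J (zone z) ⟦ B ⟧F)
    ηD  : DiagTerm [] (Out I)
    νD  : ∀ (z : Z) → DiagTerm (J (zone z) ⊤) []
    χD  : ∀ {z z'} → z ≼ z' → (X : Obj) → DiagTerm (J (zone z) X) (J (zone z') X)
    ωD  : ∀ (z : Z) → 𝒲 z → (X : Obj) → DiagTerm (J (zone z) X) []
    δD  : ∀ (z : Z) → 𝒞𝓏 z → (X : Obj) →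
          DiagTerm (J (zone z) X) (J (zone z) X ++ J (zone z) X)
    _∘D_ : ∀ {Γ Δ Θ} → DiagTerm Δ Θ → DiagTerm Γ Δ → DiagTerm Γ Θ
    _⊗D_ : ∀ {Γ Δ Γ' Δ'} → DiagTerm Γ Δ → DiagTerm Γ' Δ' →
           DiagTerm (Γ ++ Γ') (Δ ++ Δ')

  ⟦_⟧D : ∀ {Γ Δ} → DiagTerm Γ Δ → ArchHom Γ Δ
  ⟦ idD Γ ⟧D = idA
  ⟦ assocD Γ Δ Θ ⟧D = assocA Γ Δ Θ
  ⟦ assocD⁻¹ Γ Δ Θ ⟧D = assocA⁻¹ Γ Δ Θ
  ⟦ lunitD Γ ⟧D = lunitA Γ
  ⟦ lunitD⁻¹ Γ ⟧D = lunitA⁻¹ Γ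
  ⟦ runitD Γ ⟧D = runitA Γ
  ⟦ runitD⁻¹ Γ ⟧D = runitA⁻¹ Γ
  ⟦ symD Γ Δ ⟧D = symA Γ Δ
  ⟦ rD z A ⟧D = ⟦ ⊤ , π₂ ⟧
  ⟦ ιD z A ⟧D = ⟦ ⊤ , π₂ ⟧
  ⟦ τD A B ⟧D = ⟦ ⊤ , π₂ ⟧
  ⟦ μD z A B ⟧D = ⟦ ⊤ , π₂ ⟧
  ⟦ ηD ⟧D = ⟦ ⊤ , π₂ ⟧
  ⟦ νD z ⟧D = ⟦ ⊤ , π₂ ⟧
  ⟦ χD p X ⟧D = χ p X
  ⟦ ωD z w X ⟧D = ω w X
  ⟦ δD z c X ⟧D = δ c X
  ⟦ g ∘D f ⟧D = ⟦ g ⟧D ∘A ⟦ f ⟧D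
  ⟦ f ⊗D g ⟧D = ⟦ f ⟧D ⊗A ⟦ g ⟧D

  InDiag : ∀ {Γ Δ} → ArchHom Γ Δ → Set (o ⊔ ℓ ⊔ e)
  InDiag {Γ} {Δ} f = Σ[ d ∈ DiagTerm Γ Δ ] (⟦ d ⟧D ≈A f)

  data UsesDiscard (z : Z) : ∀ {Γ Δ} → DiagTerm Γ Δ → Set o where
    here : ∀ w X → UsesDiscard z (ωD z w X)
    ∘ˡ : ∀ {Γ Δ Θ} {g : DiagTerm Δ Θ} {f : DiagTerm Γ Δ} → UsesDiscard z g → UsesDiscard z (g ∘D f)
    ∘ʳ : ∀ {Γ Δ Θ} {g : DiagTerm Δ Θ} {f : DiagTerm Γ Δ} → UsesDiscard z f → UsesDiscard z (g ∘D f)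
    ⊗ˡ : ∀ {Γ Δ Γ' Δ'} {f : DiagTerm Γ Δ} {g : DiagTerm Γ' Δ'} → UsesDiscard z f → UsesDiscard z (f ⊗D g)
    ⊗ʳ : ∀ {Γ Δ Γ' Δ'} {f : DiagTerm Γ Δ} {g : DiagTerm Γ' Δ'} → UsesDiscard z g → UsesDiscard z (f ⊗D g)

  data UsesDiagonal (z : Z) : ∀ {Γ Δ} → DiagTerm Γ Δ → Set o where
    here : ∀ c X → UsesDiagonal z (δD z c X)
    ∘ˡ : ∀ {Γ Δ Θ} {g : DiagTerm Δ Θ} {f : DiagTerm Γ Δ} → UsesDiagonal z g → UsesDiagonal z (g ∘D f)
    ∘ʳ : ∀ {Γ Δ Θ} {g : DiagTerm Δ Θ} {f : DiagTerm Γ Δ} → UsesDiagonal z f → UsesDiagonal z (g ∘D f)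
    ⊗ˡ : ∀ {Γ Δ Γ' Δ'} {f : DiagTerm Γ Δ} {g : DiagTerm Γ' Δ'} → UsesDiagonal z f → UsesDiagonal z (f ⊗D g)
    ⊗ʳ : ∀ {Γ Δ Γ' Δ'} {f : DiagTerm Γ Δ} {g : DiagTerm Γ' Δ'} → UsesDiagonal z g → UsesDiagonal z (f ⊗D g)

module Submission where

-- Each rule of TZ is interpreted by a diagram built from the generators of Diag_Lic:
-- exchange by symmetries, the right rules and cut by the interface blocks τ, η, r, ι,
-- the left rules by μ and ν, and W_z, C_z by the discard ω_z and the diagonal δ_z on
-- the active formula.  The morphism is the denotation of that diagram, so it lies in
-- Diag_Lic by reflexivity, and a final W_z or C_z visibly occurs in the diagram.

open import Defs
open import Level using (Level)
open import Data.Product using (Σ; _,_; Σ-syntax; _×_)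
open import Data.List using ([]; _∷_; _++_)
open import Data.List.Relation.Binary.Permutation.Propositional using (_↭_; refl; prep; swap; trans)
open import Relation.Binary using (IsEquivalence)
open import Relation.Binary.PropositionalEquality using (_≡_; refl; cong; subst)

module FPCatProperties {o ℓ e : Level} (𝒞 : FPCat o ℓ e) where
  open FPCat 𝒞
  private module ≈ {A B : Obj} = IsEquivalence (≈-equiv {A} {B})

  id-isIso : ∀ {X} → IsIso (id {X})
  id-isIso = record { inv = id ; isoˡ = identityˡ ; isoʳ = identityˡ }

  ⊗₁-identity : ∀ {X Y} → id {X} ⊗₁ id {Y} ≈ id
  ⊗₁-identity = ≈.sym (⟨⟩-unique (≈.trans identityʳ (≈.sym identityˡ))
                                 (≈.trans identityʳ (≈.sym identityˡ)))

module ArchProperties {o ℓ e : Level} (𝒞 : FPCat o ℓ e) (Z : Set) where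
  open FPCat 𝒞
  open Arch 𝒞 Z
  open FPCatProperties 𝒞
  private module ≈ {A B : Obj} = IsEquivalence (≈-equiv {A} {B})

  ≈A-refl : ∀ {Γ Δ} (f : ArchHom Γ Δ) → f ≈A f
  ≈A-refl ⟦ P , φ ⟧ = id , id-isIso , ≈.trans (∘-resp-≈ ≈.refl ⊗₁-identity) identityʳ

module Interpretation {o ℓ e : Level} (𝒞 : FPCat o ℓ e) (Z : Set) (Lic : Discipline 𝒞 Z)
    (Atom : Set) (ρ : Atom → FPCat.Obj 𝒞) where
  open Semantics 𝒞 Z Lic Atom ρ

  ⟦⟧C-++ : ∀ Γ Δ → ⟦ Γ ++ Δ ⟧C ≡ ⟦ Γ ⟧C ++ ⟦ Δ ⟧C
  ⟦⟧C-++ [] Δ = refl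
  ⟦⟧C-++ ((z , A) ∷ Γ) Δ = cong (J (zone z) ⟦ A ⟧F ++_) (⟦⟧C-++ Γ Δ)

  ≡⇒DiagTerm : ∀ {X Y} → X ≡ Y → DiagTerm X Y
  ≡⇒DiagTerm {X} X≡Y = subst (DiagTerm X) X≡Y (idD X)

  ↭⇒DiagTerm : ∀ {Γ Γ'} → Γ ↭ Γ' → DiagTerm ⟦ Γ ⟧C ⟦ Γ' ⟧C
  ↭⇒DiagTerm {Γ} refl = idD ⟦ Γ ⟧C
  ↭⇒DiagTerm (prep (z , A) p) = idD (J (zone z) ⟦ A ⟧F) ⊗D ↭⇒DiagTerm p
  ↭⇒DiagTerm (swap (z , A) (y , B) p) =
    assocD (J (zone y) ⟦ B ⟧F) (J (zone z) ⟦ A ⟧F) _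
      ∘D ((symD (J (zone z) ⟦ A ⟧F) (J (zone y) ⟦ B ⟧F) ⊗D ↭⇒DiagTerm p)
      ∘D assocD⁻¹ (J (zone z) ⟦ A ⟧F) (J (zone y) ⟦ B ⟧F) _)
  ↭⇒DiagTerm (trans p q) = ↭⇒DiagTerm q ∘D ↭⇒DiagTerm p

  onHead : ∀ {X Y} Γ → DiagTerm X Y → DiagTerm (X ++ ⟦ Γ ⟧C) (Y ++ ⟦ Γ ⟧C)
  onHead Γ f = f ⊗D idD ⟦ Γ ⟧C

  ⟦_⟧π : ∀ {Γ A} → Γ ⊢ A → DiagTerm ⟦ Γ ⟧C (Out A)
  ⟦ ax {z = z} {A} p ⟧π = rD z A ∘D (runitD (J (zone z) ⟦ A ⟧F) ∘D ↭⇒DiagTerm p)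
  ⟦ IR p ⟧π = ηD ∘D ↭⇒DiagTerm p
  ⟦ ⊗R {Γ₁ = Γ₁} {Γ₂} {A} {B} p d₁ d₂ ⟧π =
    τD A B ∘D ((⟦ d₁ ⟧π ⊗D ⟦ d₂ ⟧π) ∘D (≡⇒DiagTerm (⟦⟧C-++ Γ₁ Γ₂) ∘D ↭⇒DiagTerm p))
  ⟦ ⊗L {Γ = Γ} {z} {A} {B} p d ⟧π =
    ⟦ d ⟧π ∘D (assocD (J (zone z) ⟦ A ⟧F) (J (zone z) ⟦ B ⟧F) ⟦ Γ ⟧C
           ∘D (onHead Γ (μD z A B) ∘D ↭⇒DiagTerm p))
  ⟦ IL {Γ = Γ} {z = z} p d ⟧π = ⟦ d ⟧π ∘D (onHead Γ (νD z) ∘D ↭⇒DiagTerm p)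
  ⟦ cut {Γ = Γ} {Δ} {z} {A} p d₁ d₂ ⟧π =
    ⟦ d₂ ⟧π ∘D (onHead Δ (ιD z A ∘D ⟦ d₁ ⟧π) ∘D (≡⇒DiagTerm (⟦⟧C-++ Γ Δ) ∘D ↭⇒DiagTerm p))
  ⟦ W {Γ = Γ} {A} z w p d ⟧π = ⟦ d ⟧π ∘D (onHead Γ (ωD z w ⟦ A ⟧F) ∘D ↭⇒DiagTerm p)
  ⟦ C {Γ = Γ} {A} z c p d ⟧π = ⟦ d ⟧π ∘D (onHead Γ (δD z c ⟦ A ⟧F) ∘D ↭⇒DiagTerm p)

  LastRuleW⇒UsesDiscard : ∀ {Γ A} (π : Γ ⊢ A) z → LastRuleW π z → UsesDiscard z ⟦ π ⟧π
  LastRuleW⇒UsesDiscard (W z w p d) .z refl = ∘ʳ (∘ˡ (⊗ˡ (here w _)))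

  LastRuleC⇒UsesDiagonal : ∀ {Γ A} (π : Γ ⊢ A) z → LastRuleC π z → UsesDiagonal z ⟦ π ⟧π
  LastRuleC⇒UsesDiagonal (C z c p d) .z refl = ∘ʳ (∘ˡ (⊗ˡ (here c _)))

theorem4p8 : ∀ {o ℓ e : Level} (𝒞 : FPCat o ℓ e) (Z : Set) (Lic : Discipline 𝒞 Z)
    (Atom : Set) (ρ : Atom → FPCat.Obj 𝒞)
    {Γ : Semantics.ZCtx 𝒞 Z Lic Atom ρ} {A : Semantics.Form 𝒞 Z Lic Atom ρ}
    (π : Semantics._⊢_ 𝒞 Z Lic Atom ρ Γ A) →
    Σ[ f ∈ Semantics.ArchHom 𝒞 Z Lic Atom ρ (Semantics.⟦_⟧C 𝒞 Z Lic Atom ρ Γ) (Semantics.Out 𝒞 Z Lic Atom ρ A) ]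
    Σ[ d ∈ Semantics.DiagTerm 𝒞 Z Lic Atom ρ (Semantics.⟦_⟧C 𝒞 Z Lic Atom ρ Γ) (Semantics.Out 𝒞 Z Lic Atom ρ A) ]
      ((Semantics._≈A_ 𝒞 Z Lic Atom ρ (Semantics.⟦_⟧D 𝒞 Z Lic Atom ρ d) f)
      × (∀ (z : Z) → Semantics.LastRuleW 𝒞 Z Lic Atom ρ π z → Semantics.UsesDiscard 𝒞 Z Lic Atom ρ z d)
      × (∀ (z : Z) → Semantics.LastRuleC 𝒞 Z Lic Atom ρ π z → Semantics.UsesDiagonal 𝒞 Z Lic Atom ρ z d))
theorem4p8 𝒞 Z Lic Atom ρ π =
  ⟦ ⟦ π ⟧π ⟧D , ⟦ π ⟧π , ≈A-refl ⟦ ⟦ π ⟧π ⟧D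
  , LastRuleW⇒UsesDiscard π , LastRuleC⇒UsesDiagonal π
  where
    open Semantics 𝒞 Z Lic Atom ρ using (⟦_⟧D)
    open ArchProperties 𝒞 Z using (≈A-refl)
    open Interpretation 𝒞 Z Lic Atom ρ
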